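{- Let $k$ be a positive integer and let $p$ be a prime such that (a) $p\equiv 1\pmod{2k}$ and (b) the elements $1^{(p-1)/k},2^{(p-1)/k},\ldots,k^{(p-1)/k}$ of $\mathbb{Z}_p^\ast$ are pairwise distinct. Then both $[1,k]$ and $[-k,k]^\ast$ split $\mathbb{Z}_p$.
   Context: $[a,b]=\{a,a+1,\ldots,b\}$ and $[a,b]^\ast=[a,b]\setminus\{0\}$ for integers $a\le b$. $\mathbb{Z}_p^\ast=\mathbb{Z}_p\setminus\{0\}$. For a finite group $G$ (written additively) and a set $M$ of integers, $M$ splits $G$ if there is a subset $S\subseteq G$ such that every nonzero $g\in G$ has a unique representation $g=ms$ with $m\in M$, $s\in S$, while $0$ has no such representation (here $ms$ is the $m$-fold sum of $s$ for $m\ge0$ and $-((-m)s)$ for $m<0$). -}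

module Defs where

open import Data.Nat as ℕ using (ℕ; NonZero)
open import Data.Integer as ℤ using (ℤ; +_; _%ℕ_)
open import Data.Fin using (Fin; toℕ)
open import Data.Product using (_×_; Σ; ∃; _,_)
open import Data.Empty using (⊥)
open import Relation.Binary.PropositionalEquality using (_≡_; _≢_)
open import Relation.Nullary using (¬_)

-- The cyclic group ℤ_p is modelled as Fin p (residues 0..p-1, addition mod p).
-- For an integer m and s ∈ ℤ_p, the element m·s (the m-fold sum of s for m ≥ 0,
-- and -((-m)s) for m < 0) is the residue of the integer product m * s modulo p.
smul : (p : ℕ) .{{_ : NonZero p}} → ℤ → Fin p → ℕ
smul p m s = (m ℤ.* + toℕ s) %ℕ p

Splits : (p : ℕ) .{{_ : NonZero p}} → (ℤ → Set) → Set₁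
Splits p M =
  Σ (Fin p → Set) λ S →
    ((g : Fin p) → toℕ g ≢ 0 →
       Σ ℤ λ m → Σ (Fin p) λ s → M m × S s × smul p m s ≡ toℕ g ×
         ((m′ : ℤ) (s′ : Fin p) → M m′ → S s′ → smul p m′ s′ ≡ toℕ g →
            (m′ ≡ m) × (s′ ≡ s)))
    × ((m : ℤ) (s : Fin p) → M m → S s → smul p m s ≢ 0)

Interval1 : ℕ → ℤ → Set
Interval1 k m = (+ 1 ℤ.≤ m) × (m ℤ.≤ + k)

IntervalSym : ℕ → ℤ → Set
IntervalSym k m = (ℤ.- (+ k) ℤ.≤ m) × (m ℤ.≤ + k) × (m ≢ + 0)

-- Let e = (p - 1)/k, which is even.  By Fermat, x ↦ x^e maps ℤ_p^* into the roots of y^k = 1,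
-- of which there are at most k (Lagrange's bound for polynomials over a field); by (b) the k
-- values 1^e, …, k^e are distinct such roots, hence they are all of them.  So every g ≠ 0 has
-- g^e = m^e for exactly one m ∈ [1,k], and then g = m s with s in the kernel S = {s : s^e = 1},
-- uniquely: [1,k] splits ℤ_p with S.  As e is even, -1 ∈ S, and [-k,k]* splits ℤ_p with the
-- elements of S in [1,(p-1)/2]: when s lies in the upper half, write g = (-m)(-s) instead.

module Submission where

open import Defs
import Algebra.Properties.CommutativeSemigroup as CommutativeSemigroupProperties
import Algebra.Properties.CommutativeSemiring.Binomial as CommutativeSemiringBinomial
import Algebra.Properties.CommutativeSemiring.Exp as CommutativeSemiringExp
import Algebra.Properties.Semiring.Exp as SemiringExp
import Algebra.Properties.Semiring.Mult as SemiringMult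
import Algebra.Properties.Semiring.Sum as SemiringSum
import Data.Fin.Properties as Finₚ
import Data.Integer.DivMod as ℤ
import Data.Integer.Divisibility.Signed as Signed
import Data.Integer.Properties as ℤ
import Data.Nat.DivMod as ℕ
import Data.Nat.Properties as ℕ
import Relation.Binary.Reasoning.Setoid
open import Data.Empty using (⊥-elim)
open import Data.Fin as Fin using (Fin; toℕ; fromℕ; inject₁)
open import Data.Integer as ℤ
  using (ℤ; +_; -[1+_]; _+_; _*_; _-_; -_; ∣_∣; _^_; _⊖_; _%ℕ_; 1ℤ; 0ℤ; +≤+; -≤-; -≤+)
open import Data.Integer.Tactic.RingSolver using (solve-∀; solve)
open import Data.List using ([]; _∷_)
open import Data.Nat as ℕ using (ℕ; zero; suc; NonZero; z≤n; s≤s; _!)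
open import Data.Nat.Combinatorics using (_C_; nCk≡n!/k![n-k]!; k![n∸k]!∣n!; nCn≡1)
open import Data.Nat.Divisibility
  using (_∣_; divides; _∣?_; ∣⇒≤; >⇒∤; ∣-trans; m∣m*n; n∣m*n; *-cancelʳ-∣; ∣m+n∣m⇒∣n)
open import Data.Nat.Primality using (Prime; euclidsLemma; prime⇒nonZero; prime⇒nonTrivial)
open import Data.Product using (Σ; _×_; _,_; proj₁)
open import Data.Sum as Sum using (_⊎_; inj₁; inj₂)
open import Data.Vec.Functional as Vector using (Vector; tail; init; last)
open import Function using (_∘_; id)
open import Level using (0ℓ)
open import Relation.Binary.Bundles using (Setoid)
open import Relation.Binary.PropositionalEquality
open import Relation.Binary.Structures using (IsEquivalence)
open import Relation.Nullary using (¬_; Dec; yes; no; contradiction)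
open import Relation.Nullary.Decidable using (map′)

module Binomial = CommutativeSemiringBinomial ℤ.+-*-commutativeSemiring
module CommExp = CommutativeSemiringExp ℤ.+-*-commutativeSemiring
module Exp = SemiringExp ℤ.+-*-semiring
module Mult = SemiringMult ℤ.+-*-semiring
module VecSum = SemiringSum ℤ.+-*-semiring
open CommutativeSemigroupProperties ℤ.*-commutativeSemigroup using (x∙yz≈y∙xz)

semiring-^≡^ : ∀ x m → x Exp.^ m ≡ x ^ m
semiring-^≡^ x zero    = refl
semiring-^≡^ x (suc m) = cong (x *_) (semiring-^≡^ x m)

semiring-×≡* : ∀ m x → m Mult.× x ≡ + m * x
semiring-×≡* zero    x = sym (ℤ.*-zeroˡ x)
semiring-×≡* (suc m) x = begin
  x + m Mult.× x  ≡⟨ cong (_+_ x) (semiring-×≡* m x) ⟩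
  x + + m * x     ≡⟨ cong (λ y → y + + m * x) (ℤ.*-identityˡ x) ⟨
  1ℤ * x + + m * x ≡⟨ ℤ.*-distribʳ-+ x 1ℤ (+ m) ⟨
  (1ℤ + + m) * x  ∎
  where open ≡-Reasoning

binomialTerm-first : ∀ x m → Binomial.binomialTerm x 1ℤ m Fin.zero ≡ 1ℤ
binomialTerm-first x m = begin
  (1ℤ * 1ℤ Exp.^ m) + 0ℤ  ≡⟨ ℤ.+-identityʳ _ ⟩
  1ℤ * 1ℤ Exp.^ m         ≡⟨ ℤ.*-identityˡ _ ⟩
  1ℤ Exp.^ m              ≡⟨ semiring-^≡^ 1ℤ m ⟩
  1ℤ ^ m                  ≡⟨ ℤ.^-zeroˡ m ⟩
  1ℤ                      ∎
  where open ≡-Reasoning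

binomialTerm-last : ∀ x m → Binomial.binomialTerm x 1ℤ m (fromℕ m) ≡ x ^ m
binomialTerm-last x m = begin
  Binomial.binomialTerm x 1ℤ m (fromℕ m)
    ≡⟨ cong (λ j → (m C j) Mult.× (x Exp.^ j * 1ℤ Exp.^ (m ℕ.∸ j))) (Finₚ.toℕ-fromℕ m) ⟩
  (m C m) Mult.× (x Exp.^ m * 1ℤ Exp.^ (m ℕ.∸ m))
    ≡⟨ cong₂ (λ c e → c Mult.× (x Exp.^ m * 1ℤ Exp.^ e)) (nCn≡1 m) (ℕ.n∸n≡0 m) ⟩
  x Exp.^ m * 1ℤ + 0ℤ  ≡⟨ ℤ.+-identityʳ _ ⟩
  x Exp.^ m * 1ℤ       ≡⟨ ℤ.*-identityʳ _ ⟩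
  x Exp.^ m            ≡⟨ semiring-^≡^ x m ⟩
  x ^ m                ∎
  where open ≡-Reasoning

n∣n! : ∀ n .{{_ : NonZero n}} → n ∣ n !
n∣n! (suc n) = m∣m*n (n !)

pos-^ : ∀ n m → + (n ℕ.^ m) ≡ (+ n) ^ m
pos-^ n zero    = refl
pos-^ n (suc m) = trans (ℤ.pos-* n (n ℕ.^ m)) (cong (+ n *_) (pos-^ n m))

+-sub-+ : ∀ a b c d → (a + c) - (b + d) ≡ (a - b) + (c - d)
+-sub-+ = solve-∀

^-distribʳ-* : ∀ a b n → (a * b) ^ n ≡ a ^ n * b ^ n
^-distribʳ-* a b n = begin
  (a * b) ^ n              ≡⟨ semiring-^≡^ (a * b) n ⟨
  (a * b) Exp.^ n          ≡⟨ CommExp.^-distrib-* a b n ⟩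
  a Exp.^ n * b Exp.^ n    ≡⟨ cong₂ _*_ (semiring-^≡^ a n) (semiring-^≡^ b n) ⟩
  a ^ n * b ^ n            ∎
  where open ≡-Reasoning

neg-^-even : ∀ a t → (- a) ^ (t ℕ.* 2) ≡ a ^ (t ℕ.* 2)
neg-^-even a t = begin
  (- a) ^ (t ℕ.* 2)  ≡⟨ cong ((- a) ^_) (ℕ.*-comm t 2) ⟩
  (- a) ^ (2 ℕ.* t)  ≡⟨ ℤ.^-*-assoc (- a) 2 t ⟨
  ((- a) ^ 2) ^ t    ≡⟨ cong (_^ t) (square a) ⟩
  (a ^ 2) ^ t        ≡⟨ ℤ.^-*-assoc a 2 t ⟩
  a ^ (2 ℕ.* t)      ≡⟨ cong (a ^_) (ℕ.*-comm 2 t) ⟩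
  a ^ (t ℕ.* 2)      ∎
  where
  open ≡-Reasoning
  square : ∀ a → (- a) * ((- a) * 1ℤ) ≡ a * (a * 1ℤ)
  square = solve-∀

∣∣-^-even : ∀ a t → (+ ∣ a ∣) ^ (t ℕ.* 2) ≡ a ^ (t ℕ.* 2)
∣∣-^-even a t with ℤ.+∣i∣≡i⊎+∣i∣≡-i a
... | inj₁ ∣a∣≡a  = cong (_^ (t ℕ.* 2)) ∣a∣≡a
... | inj₂ ∣a∣≡-a = trans (cong (_^ (t ℕ.* 2)) ∣a∣≡-a) (neg-^-even a t)

∣i∣≡∣j∣⇒i≡j⊎i≡-j : ∀ i j → ∣ i ∣ ≡ ∣ j ∣ → i ≡ j ⊎ i ≡ - j
∣i∣≡∣j∣⇒i≡j⊎i≡-j (+ m)    (+ n)    ∣i∣≡∣j∣ = inj₁ (cong +_ ∣i∣≡∣j∣)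
∣i∣≡∣j∣⇒i≡j⊎i≡-j -[1+ m ] -[1+ n ] ∣i∣≡∣j∣ = inj₁ (cong -[1+_] (ℕ.suc-injective ∣i∣≡∣j∣))
∣i∣≡∣j∣⇒i≡j⊎i≡-j (+ m)    -[1+ n ] refl    = inj₂ refl
∣i∣≡∣j∣⇒i≡j⊎i≡-j -[1+ m ] (+ n)    refl    = inj₂ refl

+-<-halves : ∀ {a b n} → a ℕ.+ a ℕ.< n → b ℕ.+ b ℕ.< n → a ℕ.+ b ℕ.< n
+-<-halves {a} {b} a+a<n b+b<n with ℕ.≤-total a b
... | inj₁ a≤b = ℕ.≤-<-trans (ℕ.+-monoˡ-≤ b a≤b) b+b<n
... | inj₂ b≤a = ℕ.≤-<-trans (ℕ.+-monoʳ-≤ a b≤a) a+a<n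

odd-halves : ∀ {p s} → ¬ 2 ∣ p → s ℕ.< p → ¬ s ℕ.+ s ℕ.< p → (p ℕ.∸ s) ℕ.+ (p ℕ.∸ s) ℕ.< p
odd-halves {p} {s} p-odd s<p s+s≮p = begin-strict
  (p ℕ.∸ s) ℕ.+ (p ℕ.∸ s)  <⟨ ℕ.+-monoʳ-< (p ℕ.∸ s) p∸s<s ⟩
  (p ℕ.∸ s) ℕ.+ s          ≡⟨ p∸s+s≡p ⟩
  p                        ∎
  where
  open ℕ.≤-Reasoning
  p∸s+s≡p : (p ℕ.∸ s) ℕ.+ s ≡ p
  p∸s+s≡p = ℕ.m∸n+n≡m (ℕ.<⇒≤ s<p)
  p≢s+s : p ≢ s ℕ.+ s
  p≢s+s p≡s+s = p-odd (divides s (trans p≡s+s (trans (cong (s ℕ.+_) (sym (ℕ.+-identityʳ s))) (ℕ.*-comm 2 s))))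
  p∸s<s : p ℕ.∸ s ℕ.< s
  p∸s<s = ℕ.+-cancelʳ-< s (p ℕ.∸ s) s
            (subst (ℕ._< s ℕ.+ s) (sym p∸s+s≡p) (ℕ.≤∧≢⇒< (ℕ.≮⇒≥ s+s≮p) p≢s+s))

Interval1⇒+∣∣≡ : ∀ {k m} → Interval1 k m → + ∣ m ∣ ≡ m
Interval1⇒+∣∣≡ {m = + n} _ = refl

IntervalSym⇒∣∣-bounds : ∀ {k m} → IntervalSym k m → 1 ℕ.≤ ∣ m ∣ × ∣ m ∣ ℕ.≤ k
IntervalSym⇒∣∣-bounds {m = + zero}            (_ , _ , m≢0)       = contradiction refl m≢0
IntervalSym⇒∣∣-bounds {m = + suc n}           (_ , +≤+ n<k , _)    = s≤s z≤n , n<k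
IntervalSym⇒∣∣-bounds {suc k} { -[1+ n ] } (-≤- n≤k , _ , _) = s≤s z≤n , s≤s n≤k

∣∣-bounds⇒IntervalSym : ∀ {k m} → 1 ℕ.≤ ∣ m ∣ → ∣ m ∣ ℕ.≤ k → IntervalSym k m
∣∣-bounds⇒IntervalSym {m = + suc n}          _ n<k         = ℤ.neg-≤-pos , +≤+ n<k , λ ()
∣∣-bounds⇒IntervalSym {suc k} { -[1+ n ] } _ (s≤s n≤k) = -≤- n≤k , -≤+ , λ ()

Interval1⇒IntervalSym : ∀ {k m} → Interval1 k m → IntervalSym k m
Interval1⇒IntervalSym {m = + n} (+≤+ 1≤n , +≤+ n≤k) = ∣∣-bounds⇒IntervalSym 1≤n n≤k

IntervalSym-neg : ∀ {k m} → IntervalSym k m → IntervalSym k (- m)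
IntervalSym-neg {m = m} m∈ with IntervalSym⇒∣∣-bounds m∈
... | 1≤∣m∣ , ∣m∣≤k = ∣∣-bounds⇒IntervalSym (subst (1 ℕ.≤_) (sym (ℤ.∣-i∣≡∣i∣ m)) 1≤∣m∣)
                                           (subst (ℕ._≤ _) (sym (ℤ.∣-i∣≡∣i∣ m)) ∣m∣≤k)

-- Polynomial functions

-- h agrees with an integer polynomial of degree < n.  The degree is tracked through the
-- factor theorem instead of coefficients: every divided difference of h has degree < n - 1.
DegreeBelow : ℕ → (ℤ → ℤ) → Set
DegreeBelow zero    h = ∀ x → h x ≡ 0ℤ
DegreeBelow (suc n) h = ∀ r → Σ (ℤ → ℤ) λ g → DegreeBelow n g × (∀ x → h x - h r ≡ (x - r) * g x)

DegreeBelow-zero : ∀ n → DegreeBelow n (λ _ → 0ℤ)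
const-DegreeBelow : ∀ n c → DegreeBelow (suc n) (λ _ → c)

DegreeBelow-zero zero    _ = refl
DegreeBelow-zero (suc n)   = const-DegreeBelow n 0ℤ

const-DegreeBelow n c r =
  (λ _ → 0ℤ) , DegreeBelow-zero n , λ x → trans (ℤ.+-inverseʳ c) (sym (ℤ.*-zeroʳ (x - r)))

DegreeBelow-suc : ∀ n {h} → DegreeBelow n h → DegreeBelow (suc n) h
DegreeBelow-suc zero    {h} h≡0 r =
  (λ _ → 0ℤ) , DegreeBelow-zero 0 , λ x → trans (cong₂ _-_ (h≡0 x) (h≡0 r)) (sym (ℤ.*-zeroʳ (x - r)))
DegreeBelow-suc (suc n) deg r with deg r
... | g , deg-g , h-factor = g , DegreeBelow-suc n deg-g , h-factor

DegreeBelow-+ : ∀ n {f g} → DegreeBelow n f → DegreeBelow n g → DegreeBelow n (λ x → f x + g x)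
DegreeBelow-+ zero    f≡0 g≡0 x = cong₂ _+_ (f≡0 x) (g≡0 x)
DegreeBelow-+ (suc n) {f} {g} deg-f deg-g r with deg-f r | deg-g r
... | a , deg-a , f-factor | b , deg-b , g-factor =
  (λ x → a x + b x) , DegreeBelow-+ n deg-a deg-b , λ x → begin
    (f x + g x) - (f r + g r)      ≡⟨ +-sub-+ (f x) (f r) (g x) (g r) ⟩
    (f x - f r) + (g x - g r)      ≡⟨ cong₂ _+_ (f-factor x) (g-factor x) ⟩
    (x - r) * a x + (x - r) * b x  ≡⟨ ℤ.*-distribˡ-+ (x - r) (a x) (b x) ⟨
    (x - r) * (a x + b x)          ∎
  where open ≡-Reasoning

DegreeBelow-*ˡ : ∀ n c {f} → DegreeBelow n f → DegreeBelow n (λ x → c * f x)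
DegreeBelow-*ˡ zero    c f≡0 x = trans (cong (c *_) (f≡0 x)) (ℤ.*-zeroʳ c)
DegreeBelow-*ˡ (suc n) c {f} deg-f r with deg-f r
... | a , deg-a , f-factor = (λ x → c * a x) , DegreeBelow-*ˡ n c deg-a , λ x → begin
    c * f x - c * f r    ≡⟨ factor-out c (f x) (f r) ⟩
    c * (f x - f r)      ≡⟨ cong (c *_) (f-factor x) ⟩
    c * ((x - r) * a x)  ≡⟨ exchange c (x - r) (a x) ⟩
    (x - r) * (c * a x)  ∎
  where
  open ≡-Reasoning
  factor-out : ∀ c u v → c * u - c * v ≡ c * (u - v)
  factor-out = solve-∀
  exchange : ∀ c u v → c * (u * v) ≡ u * (c * v)
  exchange = solve-∀

geometricSum geometricTail : ℕ → ℤ → ℤ → ℤ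
geometricSum n x r = x ^ n + geometricTail n x r
geometricTail zero    x r = 0ℤ
geometricTail (suc n) x r = r * geometricSum n x r

^-sub-^ : ∀ n x r → x ^ suc n - r ^ suc n ≡ (x - r) * geometricSum n x r
^-sub-^ zero    x r = base x r
  where
  base : ∀ x r → x * 1ℤ - r * 1ℤ ≡ (x - r) * 1ℤ
  base = solve-∀
^-sub-^ (suc n) x r = begin
  x * x ^ suc n - r * r ^ suc n
    ≡⟨ split x r (x ^ suc n) (r ^ suc n) ⟩
  (x - r) * x ^ suc n + r * (x ^ suc n - r ^ suc n)
    ≡⟨ cong (λ d → (x - r) * x ^ suc n + r * d) (^-sub-^ n x r) ⟩
  (x - r) * x ^ suc n + r * ((x - r) * geometricSum n x r)
    ≡⟨ merge x r (x ^ suc n) (geometricSum n x r) ⟩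
  (x - r) * geometricSum (suc n) x r
    ∎
  where
  open ≡-Reasoning
  split : ∀ x r X R → x * X - r * R ≡ (x - r) * X + r * (X - R)
  split = solve-∀
  merge : ∀ x r X g → (x - r) * X + r * ((x - r) * g) ≡ (x - r) * (X + r * g)
  merge = solve-∀

^-DegreeBelow : ∀ n → DegreeBelow (suc n) (_^ n)
geometricSum-DegreeBelow : ∀ n r → DegreeBelow (suc n) (λ x → geometricSum n x r)
geometricTail-DegreeBelow : ∀ n r → DegreeBelow n (λ x → geometricTail n x r)

^-DegreeBelow zero          = const-DegreeBelow 0 1ℤ
^-DegreeBelow (suc n) r     = (λ x → geometricSum n x r) , geometricSum-DegreeBelow n r , λ x → ^-sub-^ n x r
geometricSum-DegreeBelow n r =
  DegreeBelow-+ (suc n) {_^ n} {λ x → geometricTail n x r}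
    (^-DegreeBelow n) (DegreeBelow-suc n (geometricTail-DegreeBelow n r))
geometricTail-DegreeBelow zero    r _ = refl
geometricTail-DegreeBelow (suc n) r   = DegreeBelow-*ˡ (suc n) r (geometricSum-DegreeBelow n r)

module Congruence (n : ℤ) where

  infix 4 _≋_
  infixr 4 _,_
  record _≋_ (a b : ℤ) : Set where
    constructor _,_
    field
      quotient : ℤ
      equation : a ≡ b + quotient * n

  ≋-refl : ∀ {a} → a ≋ a
  ≋-refl {a} = 0ℤ , solve (a ∷ n ∷ [])

  ≋-reflexive : ∀ {a b} → a ≡ b → a ≋ b
  ≋-reflexive refl = ≋-refl

  ≋-sym : ∀ {a b} → a ≋ b → b ≋ a
  ≋-sym {b = b} (q , refl) = - q , solve (b ∷ q ∷ n ∷ [])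

  ≋-trans : ∀ {a b c} → a ≋ b → b ≋ c → a ≋ c
  ≋-trans {c = c} (q , refl) (r , refl) = r + q , solve (c ∷ q ∷ r ∷ n ∷ [])

  ≋-isEquivalence : IsEquivalence _≋_
  ≋-isEquivalence = record { refl = ≋-refl ; sym = ≋-sym ; trans = ≋-trans }

  ≋-setoid : Setoid 0ℓ 0ℓ
  ≋-setoid = record { isEquivalence = ≋-isEquivalence }

  module ≋-Reasoning = Relation.Binary.Reasoning.Setoid ≋-setoid

  +-cong : ∀ {a b c d} → a ≋ b → c ≋ d → a + c ≋ b + d
  +-cong {b = b} {d = d} (q , refl) (r , refl) = q + r , solve (b ∷ d ∷ q ∷ r ∷ n ∷ [])

  *-cong : ∀ {a b c d} → a ≋ b → c ≋ d → a * c ≋ b * d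
  *-cong {b = b} {d = d} (q , refl) (r , refl) =
    q * d + b * r + q * r * n , solve (b ∷ d ∷ q ∷ r ∷ n ∷ [])

  -‿cong : ∀ {a b} → a ≋ b → - a ≋ - b
  -‿cong {b = b} (q , refl) = - q , solve (b ∷ q ∷ n ∷ [])

  ^-congˡ : ∀ {a b} m → a ≋ b → a ^ m ≋ b ^ m
  ^-congˡ zero    a≋b = ≋-refl
  ^-congˡ (suc m) a≋b = *-cong a≋b (^-congˡ m a≋b)

  modulus≋0 : n ≋ 0ℤ
  modulus≋0 = 1ℤ , solve (n ∷ [])

  a≋b⇒a-b≋0 : ∀ {a b} → a ≋ b → a - b ≋ 0ℤ
  a≋b⇒a-b≋0 {b = b} a≋b = ≋-trans (+-cong a≋b ≋-refl) (≋-reflexive (ℤ.+-inverseʳ b))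

  a-b≋0⇒a≋b : ∀ {a b} → a - b ≋ 0ℤ → a ≋ b
  a-b≋0⇒a≋b {a} {b} a-b≋0 = begin
    a            ≡⟨ solve (a ∷ b ∷ []) ⟩
    (a - b) + b  ≈⟨ +-cong a-b≋0 ≋-refl ⟩
    0ℤ + b       ≡⟨ ℤ.+-identityˡ b ⟩
    b            ∎
    where open ≋-Reasoning

  sum≋0 : ∀ {m} (f : Vector ℤ m) → (∀ i → f i ≋ 0ℤ) → VecSum.sum f ≋ 0ℤ
  sum≋0 {zero}  f f≋0 = ≋-refl
  sum≋0 {suc m} f f≋0 = +-cong (f≋0 Fin.zero) (sum≋0 (tail f) (f≋0 ∘ Fin.suc))

  -- Only the outer two terms of the binomial expansion survive.
  freshmansDream : ∀ m .{{_ : NonZero m}} x → (∀ j → 0 ℕ.< j → j ℕ.< m → + (m C j) ≋ 0ℤ) →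
                   (x + 1ℤ) ^ m ≋ x ^ m + 1ℤ
  freshmansDream (suc m) x inner≋0 = begin
    (x + 1ℤ) ^ suc m
      ≡⟨ semiring-^≡^ (x + 1ℤ) (suc m) ⟨
    (x + 1ℤ) Exp.^ suc m
      ≡⟨ Binomial.theorem (suc m) x 1ℤ ⟩
    t₀ + VecSum.sum (tail t)
      ≡⟨ cong (_+_ t₀) (VecSum.sum-init-last (tail t)) ⟩
    t₀ + (VecSum.sum (init (tail t)) + last (tail t))
      ≈⟨ +-cong (≋-reflexive (binomialTerm-first x (suc m)))
                (+-cong (sum≋0 _ middle≋0) (≋-reflexive (binomialTerm-last x (suc m)))) ⟩
    1ℤ + (0ℤ + x ^ suc m)
      ≡⟨ cong (_+_ 1ℤ) (ℤ.+-identityˡ (x ^ suc m)) ⟩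
    1ℤ + x ^ suc m
      ≡⟨ ℤ.+-comm 1ℤ (x ^ suc m) ⟩
    x ^ suc m + 1ℤ
      ∎
    where
    open ≋-Reasoning
    t : Vector ℤ (suc (suc m))
    t = Binomial.binomialTerm x 1ℤ (suc m)
    t₀ : ℤ
    t₀ = t Fin.zero
    middle≋0 : ∀ i → init (tail t) i ≋ 0ℤ
    middle≋0 i = begin
      init (tail t) i    ≡⟨ semiring-×≡* (suc m C j) w ⟩
      + (suc m C j) * w  ≈⟨ *-cong (inner≋0 j (s≤s z≤n) j<suc-m) ≋-refl ⟩
      0ℤ * w             ≡⟨ ℤ.*-zeroˡ w ⟩
      0ℤ                 ∎
      where
      j = suc (toℕ (inject₁ i))
      w = Binomial.binomial x 1ℤ (suc m) (Fin.suc (inject₁ i))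
      j<suc-m : j ℕ.< suc m
      j<suc-m = s≤s (subst (ℕ._< m) (sym (Finₚ.toℕ-inject₁ i)) (Finₚ.toℕ<n i))

-- Arithmetic modulo a prime

module ModPrime (p : ℕ) (p-prime : Prime p) where

  instance
    p≢0 : NonZero p
    p≢0 = prime⇒nonZero p-prime

  open Congruence (+ p) public

  1<p : 1 ℕ.< p
  1<p = ℕ.nonTrivial⇒n>1 p {{prime⇒nonTrivial p-prime}}

  ≋0⇒∣ : ∀ {a} → a ≋ 0ℤ → p ∣ ∣ a ∣
  ≋0⇒∣ {a} (q , a≡qp) = Signed.∣⇒∣ᵤ {+ p} {a} (Signed.divides q (trans a≡qp (ℤ.+-identityˡ _)))

  ∣⇒≋0 : ∀ {a} → p ∣ ∣ a ∣ → a ≋ 0ℤ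
  ∣⇒≋0 {a} p∣a with Signed.∣ᵤ⇒∣ {+ p} {a} p∣a
  ... | Signed.divides q a≡qp = q , trans a≡qp (sym (ℤ.+-identityˡ _))

  *≋0⇒≋0⊎≋0 : ∀ a b → a * b ≋ 0ℤ → a ≋ 0ℤ ⊎ b ≋ 0ℤ
  *≋0⇒≋0⊎≋0 a b ab≋0 = Sum.map ∣⇒≋0 ∣⇒≋0
    (euclidsLemma ∣ a ∣ ∣ b ∣ p-prime (subst (p ∣_) (ℤ.abs-* a b) (≋0⇒∣ ab≋0)))

  ≉0-*-≉0 : ∀ {a b} → ¬ a ≋ 0ℤ → ¬ b ≋ 0ℤ → ¬ a * b ≋ 0ℤ
  ≉0-*-≉0 {a} {b} a≉0 b≉0 ab≋0 = Sum.[ a≉0 , b≉0 ] (*≋0⇒≋0⊎≋0 a b ab≋0)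

  ≋0⇒≡0 : ∀ {a} → ∣ a ∣ ℕ.< p → a ≋ 0ℤ → a ≡ 0ℤ
  ≋0⇒≡0 {a} ∣a∣<p a≋0 with ∣ a ∣ in ∣a∣≡
  ... | zero  = ℤ.∣i∣≡0⇒i≡0 ∣a∣≡
  ... | suc _ = contradiction (∣⇒≤ (subst (p ∣_) ∣a∣≡ (≋0⇒∣ a≋0))) (ℕ.<⇒≱ ∣a∣<p)

  0<d<p⇒≉0 : ∀ {d} → 0 ℕ.< d → d ℕ.< p → ¬ + d ≋ 0ℤ
  0<d<p⇒≉0 0<d d<p d≋0 = ℕ.>⇒≢ 0<d (ℤ.+-injective (≋0⇒≡0 d<p d≋0))

  +≋+⇒≡ : ∀ {r s} → r ℕ.< p → s ℕ.< p → + r ≋ + s → r ≡ s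
  +≋+⇒≡ {r} {s} r<p s<p r≋s =
    ℤ.+-injective (ℤ.i-j≡0⇒i≡j (+ r) (+ s) (≋0⇒≡0 ∣r-s∣<p (a≋b⇒a-b≋0 r≋s)))
    where
    ∣r-s∣<p : ∣ + r - + s ∣ ℕ.< p
    ∣r-s∣<p = subst (ℕ._< p) (cong ∣_∣ (sym (ℤ.m-n≡m⊖n r s)))
                (ℕ.≤-<-trans (ℤ.∣m⊝n∣≤m⊔n r s) (ℕ.⊔-pres-<m r<p s<p))

  ≋%ℕ : ∀ a → a ≋ + (a %ℕ p)
  ≋%ℕ a = a ℤ./ℕ p , ℤ.a≡a%ℕn+[a/ℕn]*n a p

  *-cancelˡ-≋ : ∀ c {a b} → ¬ c ≋ 0ℤ → c * a ≋ c * b → a ≋ b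
  *-cancelˡ-≋ c {a} {b} c≉0 ca≋cb = a-b≋0⇒a≋b (Sum.[ ⊥-elim ∘ c≉0 , id ] (*≋0⇒≋0⊎≋0 c (a - b) c[a-b]≋0))
    where
    c[a-b]≋0 : c * (a - b) ≋ 0ℤ
    c[a-b]≋0 = begin
      c * (a - b)    ≡⟨ solve (c ∷ a ∷ b ∷ []) ⟩
      c * a - c * b  ≈⟨ a≋b⇒a-b≋0 ca≋cb ⟩
      0ℤ             ∎
      where open ≋-Reasoning

  _≋?_ : ∀ a b → Dec (a ≋ b)
  a ≋? b = map′ (a-b≋0⇒a≋b ∘ ∣⇒≋0) (≋0⇒∣ ∘ a≋b⇒a-b≋0) (p ∣? ∣ a - b ∣)

  p∤n! : ∀ {n} → n ℕ.< p → ¬ p ∣ n !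
  p∤n! {zero}  _   = >⇒∤ 1<p
  p∤n! {suc n} n<p = Sum.[ >⇒∤ n<p , p∤n! (ℕ.<-trans (ℕ.n<1+n n) n<p) ] ∘ euclidsLemma (suc n) (n !) p-prime

  p∣pCj : ∀ {j} → 0 ℕ.< j → j ℕ.< p → p ∣ p C j
  p∣pCj {j} 0<j j<p = Sum.[ id , ⊥-elim ∘ p∤j![p∸j]! ] (euclidsLemma (p C j) _ p-prime p∣pCj*j![p∸j]!)
    where
    j≤p = ℕ.<⇒≤ j<p
    pCj*j![p∸j]!≡p! : (p C j) ℕ.* (j ! ℕ.* (p ℕ.∸ j) !) ≡ p !
    pCj*j![p∸j]!≡p! = trans (cong (ℕ._* (j ! ℕ.* (p ℕ.∸ j) !)) (nCk≡n!/k![n-k]! j≤p))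
                            (ℕ.m/n*n≡m {{ℕ._!*_!≢0 j (p ℕ.∸ j)}} (k![n∸k]!∣n! j≤p))
    p∣pCj*j![p∸j]! : p ∣ (p C j) ℕ.* (j ! ℕ.* (p ℕ.∸ j) !)
    p∣pCj*j![p∸j]! = subst (p ∣_) (sym pCj*j![p∸j]!≡p!) (n∣n! p)
    p∤j![p∸j]! : ¬ p ∣ j ! ℕ.* (p ℕ.∸ j) !
    p∤j![p∸j]! = Sum.[ p∤n! j<p , p∤n! (ℕ.∸-monoʳ-< 0<j j≤p) ] ∘ euclidsLemma (j !) _ p-prime

  fermat : ∀ n → (+ n) ^ p ≋ + n
  fermat zero    = ≋-reflexive (trans (cong (0ℤ ^_) (sym (ℕ.suc-pred p))) (ℤ.*-zeroˡ (0ℤ ^ (p ℕ.∸ 1))))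
  fermat (suc n) = begin
    (+ suc n) ^ p   ≡⟨ cong (_^ p) (ℤ.+-comm 1ℤ (+ n)) ⟩
    (+ n + 1ℤ) ^ p  ≈⟨ freshmansDream p (+ n) (λ _ 0<j j<p → ∣⇒≋0 (p∣pCj 0<j j<p)) ⟩
    (+ n) ^ p + 1ℤ  ≈⟨ +-cong (fermat n) ≋-refl ⟩
    + n + 1ℤ        ≡⟨ ℤ.+-comm (+ n) 1ℤ ⟩
    + suc n         ∎
    where open ≋-Reasoning

  fermat-little : ∀ n → ¬ + n ≋ 0ℤ → (+ n) ^ (p ℕ.∸ 1) ≋ 1ℤ
  fermat-little n n≉0 = *-cancelˡ-≋ (+ n) n≉0 (begin
    + n * (+ n) ^ (p ℕ.∸ 1)  ≡⟨ cong ((+ n) ^_) (ℕ.suc-pred p) ⟩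
    (+ n) ^ p                ≈⟨ fermat n ⟩
    + n                      ≡⟨ ℤ.*-identityʳ (+ n) ⟨
    + n * 1ℤ                 ∎)
    where open ≋-Reasoning

  ^-≉0 : ∀ {a} n → ¬ a ≋ 0ℤ → ¬ a ^ n ≋ 0ℤ
  ^-≉0 zero    _   = 0<d<p⇒≉0 (s≤s z≤n) 1<p
  ^-≉0 (suc n) a≉0 = ≉0-*-≉0 a≉0 (^-≉0 n a≉0)

  ^≋1⇒≉0 : ∀ {a} n .{{_ : NonZero n}} → a ^ n ≋ 1ℤ → ¬ a ≋ 0ℤ
  ^≋1⇒≉0 {a} (suc n) aⁿ≋1 a≋0 = 0<d<p⇒≉0 (s≤s z≤n) 1<p (begin
    1ℤ          ≈⟨ aⁿ≋1 ⟨
    a * a ^ n   ≈⟨ *-cong a≋0 ≋-refl ⟩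
    0ℤ * a ^ n  ≡⟨ ℤ.*-zeroˡ (a ^ n) ⟩
    0ℤ          ∎)
    where open ≋-Reasoning

  *-^≋^ : ∀ {m s g} n → s ^ n ≋ 1ℤ → m * s ≋ g → m ^ n ≋ g ^ n
  *-^≋^ {m} {s} {g} n sⁿ≋1 ms≋g = begin
    m ^ n          ≡⟨ ℤ.*-identityʳ (m ^ n) ⟨
    m ^ n * 1ℤ     ≈⟨ *-cong (≋-refl {m ^ n}) sⁿ≋1 ⟨
    m ^ n * s ^ n  ≡⟨ ^-distribʳ-* m s n ⟨
    (m * s) ^ n    ≈⟨ ^-congˡ n ms≋g ⟩
    g ^ n          ∎
    where open ≋-Reasoning

  *-^≋^⇒^≋1 : ∀ {m s g} n → ¬ m ≋ 0ℤ → m * s ≋ g → m ^ n ≋ g ^ n → s ^ n ≋ 1ℤ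
  *-^≋^⇒^≋1 {m} {s} {g} n m≉0 ms≋g mⁿ≋gⁿ = *-cancelˡ-≋ (m ^ n) (^-≉0 n m≉0) (begin
    m ^ n * s ^ n  ≡⟨ ^-distribʳ-* m s n ⟨
    (m * s) ^ n    ≈⟨ ^-congˡ n ms≋g ⟩
    g ^ n          ≈⟨ mⁿ≋gⁿ ⟨
    m ^ n          ≡⟨ ℤ.*-identityʳ (m ^ n) ⟨
    m ^ n * 1ℤ     ∎)
    where open ≋-Reasoning

  -- A polynomial function of degree d modulo p, encoded as in DegreeBelow; in degree 0 it
  -- is a unit, hence has no roots.
  HasDegree : ℕ → (ℤ → ℤ) → Set
  HasDegree zero    f = ∀ x → ¬ f x ≋ 0ℤ
  HasDegree (suc d) f = ∀ r → Σ (ℤ → ℤ) λ g → HasDegree d g × (∀ x → f x - f r ≡ (x - r) * g x)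

  monic-HasDegree : ∀ n {h} → DegreeBelow n h → HasDegree n (λ x → x ^ n + h x)
  monic-HasDegree zero    h≡0 x 1+h≋0 =
    0<d<p⇒≉0 (s≤s z≤n) 1<p (≋-trans (≋-reflexive (cong (_+_ 1ℤ) (sym (h≡0 x)))) 1+h≋0)
  monic-HasDegree (suc n) {h} deg-h r with deg-h r
  ... | q , deg-q , h-factor =
    (λ x → x ^ n + (geometricTail n x r + q x)) ,
    monic-HasDegree n (DegreeBelow-+ n {λ x → geometricTail n x r} (geometricTail-DegreeBelow n r) deg-q) ,
    λ x → begin
      (x ^ suc n + h x) - (r ^ suc n + h r)            ≡⟨ +-sub-+ (x ^ suc n) (r ^ suc n) (h x) (h r) ⟩
      (x ^ suc n - r ^ suc n) + (h x - h r)            ≡⟨ cong₂ _+_ (^-sub-^ n x r) (h-factor x) ⟩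
      (x - r) * geometricSum n x r + (x - r) * q x     ≡⟨ regroup (x - r) (x ^ n) (geometricTail n x r) (q x) ⟩
      (x - r) * (x ^ n + (geometricTail n x r + q x))  ∎
    where
    open ≡-Reasoning
    regroup : ∀ u a b c → u * (a + b) + u * c ≡ u * (a + (b + c))
    regroup = solve-∀

  ^-sub-1-HasDegree : ∀ n .{{_ : NonZero n}} → HasDegree n (λ x → x ^ n - 1ℤ)
  ^-sub-1-HasDegree (suc n) = monic-HasDegree (suc n) (const-DegreeBelow n (- 1ℤ))

  #roots≤degree : ∀ d {f n} (x : Fin n → ℤ) → HasDegree d f → (∀ i → f (x i) ≋ 0ℤ) →
                  (∀ i j → x i ≋ x j → i ≡ j) → n ℕ.≤ d
  #roots≤degree d       {n = zero}  _ _   _     _ = z≤n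
  #roots≤degree zero    {n = suc _} x f≉0 roots _ = ⊥-elim (f≉0 (x Fin.zero) (roots Fin.zero))
  #roots≤degree (suc d) {f} {suc n} x deg roots distinct with deg (x Fin.zero)
  ... | g , deg-g , f-factor =
    s≤s (#roots≤degree d (x ∘ Fin.suc) deg-g g-roots
                       (λ i j → Finₚ.suc-injective ∘ distinct (Fin.suc i) (Fin.suc j)))
    where
    g-roots : ∀ i → g (x (Fin.suc i)) ≋ 0ℤ
    g-roots i = Sum.[ ⊥-elim ∘ r≉y ∘ ≋-sym ∘ a-b≋0⇒a≋b , id ] (*≋0⇒≋0⊎≋0 (y - r) (g y) (begin
      (y - r) * g y  ≡⟨ f-factor y ⟨
      f y - f r      ≈⟨ +-cong (roots (Fin.suc i)) (-‿cong (roots Fin.zero)) ⟩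
      0ℤ             ∎))
      where
      open ≋-Reasoning
      r y : ℤ
      r = x Fin.zero
      y = x (Fin.suc i)
      r≉y : ¬ r ≋ y
      r≉y r≋y = contradiction (distinct Fin.zero (Fin.suc i) r≋y) λ ()

  roots-exhaustive : ∀ d {f} (x : Fin d → ℤ) → HasDegree d f → (∀ i → f (x i) ≋ 0ℤ) →
                     (∀ i j → x i ≋ x j → i ≡ j) → ∀ y → f y ≋ 0ℤ → Σ (Fin d) λ i → y ≋ x i
  roots-exhaustive d {f} x deg roots distinct y fy≋0 with Finₚ.any? (λ i → y ≋? x i)
  ... | yes found = found
  ... | no  y∉x   = contradiction (#roots≤degree d (y Vector.∷ x) deg roots′ distinct′) ℕ.1+n≰n
    where
    roots′ : ∀ i → f ((y Vector.∷ x) i) ≋ 0ℤ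
    roots′ Fin.zero    = fy≋0
    roots′ (Fin.suc i) = roots i
    distinct′ : ∀ i j → (y Vector.∷ x) i ≋ (y Vector.∷ x) j → i ≡ j
    distinct′ Fin.zero    Fin.zero    _     = refl
    distinct′ Fin.zero    (Fin.suc j) y≋xj  = ⊥-elim (y∉x (j , y≋xj))
    distinct′ (Fin.suc i) Fin.zero    xi≋y  = ⊥-elim (y∉x (i , ≋-sym xi≋y))
    distinct′ (Fin.suc i) (Fin.suc j) xi≋xj = cong Fin.suc (distinct i j xi≋xj)

  residue : ℤ → Fin p
  residue a = Fin.fromℕ< (ℤ.n%ℕd<d a p)

  residue-≋ : ∀ a → + toℕ (residue a) ≋ a
  residue-≋ a = ≋-trans (≋-reflexive (cong +_ (Finₚ.toℕ-fromℕ< (ℤ.n%ℕd<d a p)))) (≋-sym (≋%ℕ a))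

  toℕ-≋-injective : ∀ {s s′ : Fin p} → + toℕ s ≋ + toℕ s′ → s ≡ s′
  toℕ-≋-injective = Finₚ.toℕ-injective ∘ +≋+⇒≡ (Finₚ.toℕ<n _) (Finₚ.toℕ<n _)

  *-cancelˡ-toℕ : ∀ {m} {s s′ : Fin p} → ¬ m ≋ 0ℤ → m * + toℕ s ≋ m * + toℕ s′ → s ≡ s′
  *-cancelˡ-toℕ {m} m≉0 = toℕ-≋-injective ∘ *-cancelˡ-≋ m m≉0

  smul≡⇒≋ : ∀ m s {n} → smul p m s ≡ n → m * + toℕ s ≋ + n
  smul≡⇒≋ m s refl = ≋%ℕ (m * + toℕ s)

  ≋⇒smul≡ : ∀ m s (g : Fin p) → m * + toℕ s ≋ + toℕ g → smul p m s ≡ toℕ g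
  ≋⇒smul≡ m s g ms≋g =
    +≋+⇒≡ (ℤ.n%ℕd<d (m * + toℕ s) p) (Finₚ.toℕ<n g) (≋-trans (≋-sym (≋%ℕ (m * + toℕ s))) ms≋g)

  ∃-solution : ∀ {m} → ¬ + m ≋ 0ℤ → ∀ g → Σ (Fin p) λ s → + m * + toℕ s ≋ g
  ∃-solution {m} m≉0 g = residue (g * m⁻¹) , (begin
    + m * + toℕ (residue (g * m⁻¹))  ≈⟨ *-cong (≋-refl {+ m}) (residue-≋ (g * m⁻¹)) ⟩
    + m * (g * m⁻¹)                  ≡⟨ x∙yz≈y∙xz (+ m) g m⁻¹ ⟩
    g * (+ m * m⁻¹)                  ≡⟨ cong (λ i → g * (+ m) ^ i) p∸1≡1+[p∸2] ⟨
    g * (+ m) ^ (p ℕ.∸ 1)            ≈⟨ *-cong (≋-refl {g}) (fermat-little m m≉0) ⟩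
    g * 1ℤ                           ≡⟨ ℤ.*-identityʳ g ⟩
    g                                ∎)
    where
    open ≋-Reasoning
    m⁻¹ : ℤ
    m⁻¹ = (+ m) ^ (p ℕ.∸ 2)
    p∸1≡1+[p∸2] : p ℕ.∸ 1 ≡ suc (p ℕ.∸ 2)
    p∸1≡1+[p∸2] = ℕ.+-∸-assoc 1 1<p

  ≉0⇒>0 : ∀ {n} → ¬ + n ≋ 0ℤ → 0 ℕ.< n
  ≉0⇒>0 n≉0 = ℕ.n≢0⇒n>0 (λ n≡0 → n≉0 (≋-reflexive (cong +_ n≡0)))

  +[p∸s]≋-s : ∀ {s} → s ℕ.≤ p → + (p ℕ.∸ s) ≋ - + s
  +[p∸s]≋-s {s} s≤p = begin
    + (p ℕ.∸ s)  ≡⟨ ℤ.⊖-≥ s≤p ⟨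
    p ⊖ s        ≡⟨ ℤ.m-n≡m⊖n p s ⟨
    + p - + s    ≈⟨ +-cong modulus≋0 (≋-refl { - + s}) ⟩
    0ℤ - + s     ≡⟨ ℤ.+-identityˡ (- + s) ⟩
    - + s        ∎
    where open ≋-Reasoning

  asFin : ∀ (P : ℕ → Set) {c} → c ℕ.< p → P c → Σ (Fin p) (P ∘ toℕ)
  asFin P c<p Pc = Fin.fromℕ< c<p , subst P (sym (Finₚ.toℕ-fromℕ< c<p)) Pc

  HalfRepresentative : ℕ → ℕ → Set
  HalfRepresentative s c = c ℕ.+ c ℕ.< p × (+ c ≋ + s ⊎ + c ≋ - + s)

  ∃-halfRepresentative : ¬ 2 ∣ p → ∀ {s} → 0 ℕ.< s → s ℕ.< p → Σ (Fin p) (HalfRepresentative s ∘ toℕ)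
  ∃-halfRepresentative p-odd {s} 0<s s<p with s ℕ.+ s ℕ.<? p
  ... | yes s+s<p = asFin (HalfRepresentative s) s<p (s+s<p , inj₁ ≋-refl)
  ... | no  s+s≮p =
    asFin (HalfRepresentative s) (ℕ.∸-monoʳ-< 0<s (ℕ.<⇒≤ s<p))
          (odd-halves p-odd s<p s+s≮p , inj₂ (+[p∸s]≋-s (ℕ.<⇒≤ s<p)))

  neg-*≋*⇒+≋0 : ∀ {m a b} → ¬ m ≋ 0ℤ → - m * a ≋ m * b → a + b ≋ 0ℤ
  neg-*≋*⇒+≋0 {m} {a} {b} m≉0 -ma≋mb = Sum.[ ⊥-elim ∘ m≉0 , id ] (*≋0⇒≋0⊎≋0 m (a + b) (begin
    m * (a + b)        ≡⟨ rearrange m a b ⟩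
    m * b - - m * a    ≈⟨ a≋b⇒a-b≋0 (≋-sym -ma≋mb) ⟩
    0ℤ                 ∎))
    where
    open ≋-Reasoning
    rearrange : ∀ m a b → m * (a + b) ≡ m * b - - m * a
    rearrange = solve-∀

  splits-criterion : (M : ℤ → Set) (S : Fin p → Set) →
    (∀ {m} → M m → ¬ m ≋ 0ℤ) → (∀ {s} → S s → ¬ + toℕ s ≋ 0ℤ) →
    (∀ n → ¬ + n ≋ 0ℤ → Σ ℤ λ m → Σ (Fin p) λ s → M m × S s × m * + toℕ s ≋ + n) →
    (∀ {m m′ s s′} → M m → M m′ → S s → S s′ → m * + toℕ s ≋ m′ * + toℕ s′ → m ≡ m′ × s ≡ s′) →
    Splits p M
  splits-criterion M S M≉0 S≉0 represent unique =
    S ,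
    (λ g g≢0 →
      let (m , s , m∈M , s∈S , ms≋g) = represent (toℕ g) (0<d<p⇒≉0 (ℕ.n≢0⇒n>0 g≢0) (Finₚ.toℕ<n g))
      in m , s , m∈M , s∈S , ≋⇒smul≡ m s g ms≋g ,
         λ m′ s′ m′∈M s′∈S m′s′≡g → unique m′∈M m∈M s′∈S s∈S (≋-trans (smul≡⇒≋ m′ s′ m′s′≡g) (≋-sym ms≋g))) ,
    λ m s m∈M s∈S ms≡0 → ≉0-*-≉0 (M≉0 m∈M) (S≉0 s∈S) (smul≡⇒≋ m s ms≡0)

module Splitting (k p : ℕ) .{{_ : NonZero k}} .{{_ : NonZero p}} (p-prime : Prime p)
  (2k∣p∸1 : 2 ℕ.* k ∣ p ℕ.∸ 1)
  (powers-distinct : (i j : ℕ) → 1 ℕ.≤ i → i ℕ.≤ k → 1 ℕ.≤ j → j ℕ.≤ k →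
    (i ℕ.^ ((p ℕ.∸ 1) ℕ./ k)) ℕ.% p ≡ (j ℕ.^ ((p ℕ.∸ 1) ℕ./ k)) ℕ.% p → i ≡ j) where

  open ModPrime p p-prime hiding (p≢0)

  e : ℕ
  e = (p ℕ.∸ 1) ℕ./ k

  k∣p∸1 : k ∣ p ℕ.∸ 1
  k∣p∸1 = ∣-trans (n∣m*n 2) 2k∣p∸1

  0<p∸1 : 0 ℕ.< p ℕ.∸ 1
  0<p∸1 = ℕ.m<n⇒0<n∸m 1<p

  e*k≡p∸1 : e ℕ.* k ≡ p ℕ.∸ 1
  e*k≡p∸1 = ℕ.m/n*n≡m k∣p∸1

  instance
    e≢0 : NonZero e
    e≢0 = ℕ.≢-nonZero λ e≡0 → ℕ.>⇒≢ 0<p∸1 (trans (sym e*k≡p∸1) (cong (ℕ._* k) e≡0))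

  2∣e : 2 ∣ e
  2∣e = *-cancelʳ-∣ k (subst (2 ℕ.* k ∣_) (sym e*k≡p∸1) 2k∣p∸1)

  k<p : k ℕ.< p
  k<p = ℕ.≤-<-trans (∣⇒≤ {{ℕ.>-nonZero 0<p∸1}} k∣p∸1) (ℕ.∸-monoʳ-< ℕ.z<s (ℕ.<⇒≤ 1<p))

  p-odd : ¬ 2 ∣ p
  p-odd 2∣p = ℕ.1+n≰n (∣⇒≤ (∣m+n∣m⇒∣n 2∣[p∸1]+1 (∣-trans (m∣m*n k) 2k∣p∸1)))
    where
    2∣[p∸1]+1 : 2 ∣ (p ℕ.∸ 1) ℕ.+ 1
    2∣[p∸1]+1 = subst (2 ∣_) (sym (ℕ.m∸n+n≡m (ℕ.<⇒≤ 1<p))) 2∣p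

  neg-^e : ∀ a → (- a) ^ e ≡ a ^ e
  neg-^e a = subst (λ e → (- a) ^ e ≡ a ^ e) (sym (_∣_.equality 2∣e)) (neg-^-even a (_∣_.quotient 2∣e))

  ∣∣-^e : ∀ a → (+ ∣ a ∣) ^ e ≡ a ^ e
  ∣∣-^e a = subst (λ e → (+ ∣ a ∣) ^ e ≡ a ^ e) (sym (_∣_.equality 2∣e)) (∣∣-^-even a (_∣_.quotient 2∣e))

  IntervalSym⇒≉0 : ∀ {m} → IntervalSym k m → ¬ m ≋ 0ℤ
  IntervalSym⇒≉0 {m} m∈ m≋0 with IntervalSym⇒∣∣-bounds m∈
  ... | 1≤∣m∣ , ∣m∣≤k = ℕ.<⇒≢ 1≤∣m∣ (sym (cong ∣_∣ (≋0⇒≡0 (ℕ.≤-<-trans ∣m∣≤k k<p) m≋0)))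

  ^e-injective : ∀ {i j} → 1 ℕ.≤ i → i ℕ.≤ k → 1 ℕ.≤ j → j ℕ.≤ k → (+ i) ^ e ≋ (+ j) ^ e → i ≡ j
  ^e-injective {i} {j} 1≤i i≤k 1≤j j≤k iᵉ≋jᵉ =
    powers-distinct i j 1≤i i≤k 1≤j j≤k (+≋+⇒≡ (ℕ.m%n<n (i ℕ.^ e) p) (ℕ.m%n<n (j ℕ.^ e) p)
      (≋-trans (≋-sym (≋%ℕ (+ (i ℕ.^ e)))) (≋-trans iᵉ≋jᵉ′ (≋%ℕ (+ (j ℕ.^ e))))))
    where
    iᵉ≋jᵉ′ : + (i ℕ.^ e) ≋ + (j ℕ.^ e)
    iᵉ≋jᵉ′ = subst₂ _≋_ (sym (pos-^ i e)) (sym (pos-^ j e)) iᵉ≋jᵉ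

  ^e^k≋1 : ∀ n → ¬ + n ≋ 0ℤ → ((+ n) ^ e) ^ k ≋ 1ℤ
  ^e^k≋1 n n≉0 =
    ≋-trans (≋-reflexive (trans (ℤ.^-*-assoc (+ n) e k) (cong ((+ n) ^_) e*k≡p∸1))) (fermat-little n n≉0)

  ^e-surjective : ∀ n → ¬ + n ≋ 0ℤ → Σ ℕ λ m → 1 ℕ.≤ m × m ℕ.≤ k × (+ m) ^ e ≋ (+ n) ^ e
  ^e-surjective n n≉0 =
    let (i , nᵉ≋xᵢ) = roots-exhaustive k x (^-sub-1-HasDegree k) x-roots x-distinct
                                       ((+ n) ^ e) (a≋b⇒a-b≋0 (^e^k≋1 n n≉0))
    in suc (toℕ i) , s≤s z≤n , Finₚ.toℕ<n i , ≋-sym nᵉ≋xᵢ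
    where
    x : Fin k → ℤ
    x i = (+ suc (toℕ i)) ^ e
    x-roots : ∀ i → x i ^ k - 1ℤ ≋ 0ℤ
    x-roots i =
      a≋b⇒a-b≋0 (^e^k≋1 (suc (toℕ i)) (IntervalSym⇒≉0 (∣∣-bounds⇒IntervalSym (s≤s z≤n) (Finₚ.toℕ<n i))))
    x-distinct : ∀ i j → x i ≋ x j → i ≡ j
    x-distinct i j =
      Finₚ.toℕ-injective ∘ ℕ.suc-injective ∘ ^e-injective (s≤s z≤n) (Finₚ.toℕ<n i) (s≤s z≤n) (Finₚ.toℕ<n j)

  S₁ : Fin p → Set
  S₁ s = (+ toℕ s) ^ e ≋ 1ℤ

  decompose : ∀ n → ¬ + n ≋ 0ℤ → Σ ℕ λ m → Σ (Fin p) λ s → Interval1 k (+ m) × S₁ s × + m * + toℕ s ≋ + n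
  decompose n n≉0 =
    let (m , 1≤m , m≤k , mᵉ≋nᵉ) = ^e-surjective n n≉0
        m≉0 = IntervalSym⇒≉0 (∣∣-bounds⇒IntervalSym 1≤m m≤k)
        (s , ms≋n) = ∃-solution m≉0 (+ n)
    in m , s , (+≤+ 1≤m , +≤+ m≤k) , *-^≋^⇒^≋1 e m≉0 ms≋n mᵉ≋nᵉ , ms≋n

  magnitude-unique : ∀ {m m′ s s′} → IntervalSym k m → IntervalSym k m′ → S₁ s → S₁ s′ →
                     m * + toℕ s ≋ m′ * + toℕ s′ → ∣ m ∣ ≡ ∣ m′ ∣
  magnitude-unique {m} {m′} {s} {s′} m∈ m′∈ s∈S₁ s′∈S₁ ms≋m′s′
    with IntervalSym⇒∣∣-bounds m∈ | IntervalSym⇒∣∣-bounds m′∈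
  ... | 1≤∣m∣ , ∣m∣≤k | 1≤∣m′∣ , ∣m′∣≤k = ^e-injective 1≤∣m∣ ∣m∣≤k 1≤∣m′∣ ∣m′∣≤k (begin
    (+ ∣ m ∣) ^ e         ≡⟨ ∣∣-^e m ⟩
    m ^ e                 ≈⟨ *-^≋^ e s∈S₁ ms≋m′s′ ⟩
    (m′ * + toℕ s′) ^ e   ≈⟨ *-^≋^ e s′∈S₁ ≋-refl ⟨
    m′ ^ e                ≡⟨ ∣∣-^e m′ ⟨
    (+ ∣ m′ ∣) ^ e        ∎)
    where open ≋-Reasoning

  split₁ : Splits p (Interval1 k)
  split₁ =
    splits-criterion (Interval1 k) S₁ (IntervalSym⇒≉0 ∘ Interval1⇒IntervalSym) (^≋1⇒≉0 e) represent unique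
    where
    represent : ∀ n → ¬ + n ≋ 0ℤ → Σ ℤ λ m → Σ (Fin p) λ s → Interval1 k m × S₁ s × m * + toℕ s ≋ + n
    represent n n≉0 = let (m , rest) = decompose n n≉0 in + m , rest
    unique : ∀ {m m′ s s′} → Interval1 k m → Interval1 k m′ → S₁ s → S₁ s′ →
             m * + toℕ s ≋ m′ * + toℕ s′ → m ≡ m′ × s ≡ s′
    unique {m} {m′} {s} {s′} m∈ m′∈ s∈S₁ s′∈S₁ ms≋m′s′ =
      m≡m′ , *-cancelˡ-toℕ m≉0 (subst (λ c → m * + toℕ s ≋ c * + toℕ s′) (sym m≡m′) ms≋m′s′)
      where
      m≉0 : ¬ m ≋ 0ℤ
      m≉0 = IntervalSym⇒≉0 (Interval1⇒IntervalSym m∈)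
      m≡m′ : m ≡ m′
      m≡m′ = trans (sym (Interval1⇒+∣∣≡ m∈)) (trans (cong +_ ∣m∣≡∣m′∣) (Interval1⇒+∣∣≡ m′∈))
        where
        ∣m∣≡∣m′∣ : ∣ m ∣ ≡ ∣ m′ ∣
        ∣m∣≡∣m′∣ = magnitude-unique (Interval1⇒IntervalSym m∈) (Interval1⇒IntervalSym m′∈) s∈S₁ s′∈S₁ ms≋m′s′

  ±-^e : ∀ {c a} → c ≋ a ⊎ c ≋ - a → c ^ e ≋ a ^ e
  ±-^e (inj₁ c≋a)          = ^-congˡ e c≋a
  ±-^e {a = a} (inj₂ c≋-a) = ≋-trans (^-congˡ e c≋-a) (≋-reflexive (neg-^e a))

  ±-IntervalSym : ∀ {m c a} → IntervalSym k m → c ≋ a ⊎ c ≋ - a → Σ ℤ λ m′ → IntervalSym k m′ × m′ * c ≋ m * a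
  ±-IntervalSym {m} m∈ (inj₁ c≋a)          = m , m∈ , *-cong (≋-refl {m}) c≋a
  ±-IntervalSym {m} {c} {a} m∈ (inj₂ c≋-a) = - m , IntervalSym-neg m∈ , (begin
    - m * c      ≈⟨ *-cong (≋-refl { - m}) c≋-a ⟩
    - m * - a    ≡⟨ neg-*-neg m a ⟩
    m * a        ∎)
    where
    open ≋-Reasoning
    neg-*-neg : ∀ a b → - a * - b ≡ a * b
    neg-*-neg = solve-∀

  S₂ : Fin p → Set
  S₂ s = S₁ s × toℕ s ℕ.+ toℕ s ℕ.< p

  split₂ : Splits p (IntervalSym k)
  split₂ = splits-criterion (IntervalSym k) S₂ IntervalSym⇒≉0 (^≋1⇒≉0 e ∘ proj₁) represent unique
    where
    represent : ∀ n → ¬ + n ≋ 0ℤ → Σ ℤ λ m → Σ (Fin p) λ s → IntervalSym k m × S₂ s × m * + toℕ s ≋ + n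
    represent n n≉0 =
      let (m , s , m∈ , s∈S₁ , ms≋n) = decompose n n≉0
          (c , c-half , c≋±s) = ∃-halfRepresentative p-odd (≉0⇒>0 (^≋1⇒≉0 e s∈S₁)) (Finₚ.toℕ<n s)
          (m′ , m′∈ , m′c≋ms) = ±-IntervalSym (Interval1⇒IntervalSym m∈) c≋±s
      in m′ , c , m′∈ , (≋-trans (±-^e c≋±s) s∈S₁ , c-half) , ≋-trans m′c≋ms ms≋n
    unique : ∀ {m m′ s s′} → IntervalSym k m → IntervalSym k m′ → S₂ s → S₂ s′ →
             m * + toℕ s ≋ m′ * + toℕ s′ → m ≡ m′ × s ≡ s′
    unique {m} {m′} {s} {s′} m∈ m′∈ (s∈S₁ , s-half) (s′∈S₁ , s′-half) ms≋m′s′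
      with ∣i∣≡∣j∣⇒i≡j⊎i≡-j m m′ (magnitude-unique m∈ m′∈ s∈S₁ s′∈S₁ ms≋m′s′)
    ... | inj₁ refl = refl , *-cancelˡ-toℕ (IntervalSym⇒≉0 m∈) ms≋m′s′
    ... | inj₂ refl = ⊥-elim (0<d<p⇒≉0 0<s+s′ (+-<-halves {toℕ s} {toℕ s′} s-half s′-half)
                                         (neg-*≋*⇒+≋0 (IntervalSym⇒≉0 m′∈) ms≋m′s′))
      where
      0<s+s′ : 0 ℕ.< toℕ s ℕ.+ toℕ s′
      0<s+s′ = ℕ.<-≤-trans (≉0⇒>0 (^≋1⇒≉0 e s∈S₁)) (ℕ.m≤m+n (toℕ s) (toℕ s′))

proposition2p7 : (k p : ℕ) → .{{_ : NonZero k}} → .{{_ : NonZero p}} → Prime p →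
    (2 ℕ.* k) ∣ (p ℕ.∸ 1) →
    ((i j : ℕ) → 1 ℕ.≤ i → i ℕ.≤ k → 1 ℕ.≤ j → j ℕ.≤ k →
      (i ℕ.^ ((p ℕ.∸ 1) ℕ./ k)) ℕ.% p ≡ (j ℕ.^ ((p ℕ.∸ 1) ℕ./ k)) ℕ.% p → i ≡ j) →
    Splits p (Interval1 k) × Splits p (IntervalSym k)
proposition2p7 k p p-prime 2k∣p∸1 powers-distinct = split₁ , split₂
  where open Splitting k p p-prime 2k∣p∸1 powers-distinct
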